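{- Let $F$ be a plane forest with $n$ vertices and let $w$ be a signed labeling of $F$ on $\{1,2,\ldots,n\}$. Then, as formal power series in $x$, \[ \frac{\sum_{\sigma\in\mathcal{L}(F,w)}x^{\mathrm{des}_B(\sigma)}}{(1-x)^{n+1}}=\sum_{t\ge0}\Omega_F(w,t)\,x^t. \]
   Context: A plane forest $F$ is partially ordered by $x<_F y$ iff $y$ is a proper ancestor of $x$. In particular, the roots are the maximal elements. A signed labeling of $F$ on $\{1,\ldots,n\}$ assigns to each vertex $x$ a label $w(x)\in\{\pm1,\ldots,\pm n\}$ so that $x\mapsto|w(x)|$ is a bijection onto $\{1,\ldots,n\}$. A linear extension of $F$ is an ordering $x_1\cdots x_n$ of its vertices such that $x_j<_F x_k$ implies $j<k$. $\mathcal{L}(F,w)$ is the set of words $w(x_1)\cdots w(x_n)$ over the linear extensions $x_1\cdots x_n$ of $F$. For a word $\sigma=\sigma_1\cdots\sigma_n$ of nonzero integers, define $\mathrm{Des}_B(\sigma)=\{i:1\le i\le n-1,\ \sigma_i>\sigma_{i+1}\}\cup\{n\text{ if }\sigma_n>0\}$ and $\mathrm{des}_B(\sigma)=|\mathrm{Des}_B(\sigma)|$. A type $B$ $(F,w)$-partition is a map $f$ from the vertices of $F$ to $\mathbb{N}=\{0,1,2,\ldots\}$ satisfying three conditions: (1) $f(x)\le f(y)$ whenever $x\ge_F y$; (2) $f(x)<f(y)$ whenever $x>_F y$ and $w(x)<w(y)$; (3) $f(x)\ge1$ whenever $x$ is a root with $w(x)>0$. For $t\in\mathbb{N}$, $\Omega_F(w,t)$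 denotes the number of type $B$ $(F,w)$-partitions $f$ with $f(x)\le t$ for all vertices $x$. -}

module Defs where

open import Data.Nat using (ℕ; zero; suc; _+_; _∸_; _≤_; _<_; _≤ᵇ_)
open import Data.Nat.Combinatorics using (_C_)
open import Data.Integer as ℤ using (ℤ; +_; ∣_∣)
open import Data.Bool using (Bool; true; false; if_then_else_)
open import Data.Fin using (Fin; toℕ)
open import Data.Maybe using (Maybe; just; nothing; _>>=_)
open import Data.List using (List; []; _∷_; length; lookup; map)
open import Data.List.Membership.Propositional using (_∈_)
open import Data.List.Relation.Unary.Unique.Propositional using (Unique)
open import Data.Product using (Σ; ∃; _×_)
open import Data.Sum using (_⊎_)
open import Relation.Binary.PropositionalEquality using (_≡_)
open import Relation.Nullary using (Dec; yes; no)

-- Forests on the vertex set Fin n, given by a parent map.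
-- parent x ≡ nothing  means x is a root.

iterParent : {n : ℕ} → (Fin n → Maybe (Fin n)) → ℕ → Fin n → Maybe (Fin n)
iterParent p zero    x = just x
iterParent p (suc k) x = iterParent p k x >>= p

record Forest (n : ℕ) : Set where
  field
    parent  : Fin n → Maybe (Fin n)
    acyclic : ∀ x → iterParent parent n x ≡ nothing
open Forest public

_<[_]_ : {n : ℕ} → Fin n → Forest n → Fin n → Set
x <[ F ] y = ∃ λ k → iterParent (parent F) (suc k) x ≡ just y

_≥[_]_ : {n : ℕ} → Fin n → Forest n → Fin n → Set
x ≥[ F ] y = (x ≡ y) ⊎ (y <[ F ] x)

IsRoot : {n : ℕ} → Forest n → Fin n → Set
IsRoot F x = parent F x ≡ nothing

IsSignedLabeling : (n : ℕ) → (Fin n → ℤ) → Set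
IsSignedLabeling n w =
  (∀ x → 1 ≤ ∣ w x ∣ × ∣ w x ∣ ≤ n) ×
  (∀ x y → ∣ w x ∣ ≡ ∣ w y ∣ → x ≡ y) ×
  (∀ k → 1 ≤ k → k ≤ n → ∃ λ x → ∣ w x ∣ ≡ k)

IsLinearExtension : {n : ℕ} → Forest n → List (Fin n) → Set
IsLinearExtension F xs =
  Unique xs × (∀ x → x ∈ xs) ×
  (∀ (j k : Fin (length xs)) → lookup xs j <[ F ] lookup xs k → toℕ j < toℕ k)

InL : {n : ℕ} → Forest n → (Fin n → ℤ) → List ℤ → Set
InL F w σ = ∃ λ xs → IsLinearExtension F xs × map w xs ≡ σ

gtᵇ : ℤ → ℤ → Bool
gtᵇ a b with b ℤ.<? a
... | yes _ = true
... | no  _ = false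

desB : List ℤ → ℕ
desB []           = 0
desB (a ∷ [])     = if gtᵇ a (+ 0) then 1 else 0
desB (a ∷ b ∷ σ)  = (if gtᵇ a b then 1 else 0) + desB (b ∷ σ)

IsTypeBPartition : {n : ℕ} → Forest n → (Fin n → ℤ) → (Fin n → ℕ) → Set
IsTypeBPartition F w f =
  (∀ x y → x ≥[ F ] y → f x ≤ f y) ×
  (∀ x y → y <[ F ] x → w x ℤ.< w y → f x < f y) ×
  (∀ x → IsRoot F x → + 0 ℤ.< w x → 1 ≤ f x)

-- Coefficient of x^t in  x^d / (1-x)^(n+1)  =  Σ_m C(m+n,n) x^(m+d)

coeffShifted : (n d t : ℕ) → ℕ
coeffShifted n d t = if d ≤ᵇ t then ((t ∸ d) + n) C n else 0

{-# OPTIONS --safe #-}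

-- Sort the vertices of a type B (F,w)-partition f by decreasing value, breaking ties by
-- increasing label. The labels read in this order form a word σ ∈ L(F,w), and the values of f
-- read in the same order form a sequence t ≥ g₁ ≥ ⋯ ≥ gₙ ≥ 0 that drops strictly at every type B
-- descent of σ. This is a bijection onto such pairs: a pair determines f, and f determines the
-- reading order. For fixed σ, Pascal's rule counts these sequences as
-- C(t − des_B σ + n, n), which is the coefficient of xᵗ in x^{des_B σ}/(1 − x)^{n+1}.

module Submission where

open import Defs
open import Data.Bool using (if_then_else_)
open import Data.Fin as Fin using (Fin; toℕ)
open import Data.Integer as ℤ using (ℤ; +_)
import Data.Integer.Properties as ℤ
open import Data.List as List using (List; []; _∷_; [_]; _++_; length; map; head; allFin)
open import Data.List.Properties
  using (length-++; length-map; length-tabulate; map-cong; map-cong-local; map-injective;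
         ∷-injectiveˡ; ∷-injectiveʳ)
open import Data.List.Membership.Propositional using (_∈_; _∉_)
open import Data.List.Membership.Propositional.Properties
  using (∈-map⁺; ∈-map⁻; ∈-++⁺ˡ; ∈-++⁺ʳ; ∈-++⁻; ∈-∃++; ∈-allFin)
open import Data.List.Relation.Binary.Permutation.Propositional
  using (_↭_; prep; ↭-sym; ↭-trans; ↭⇒↭ₛ)
open import Data.List.Relation.Binary.Permutation.Propositional.Properties
  using (∈-resp-↭; shift; ↭-length)
import Data.List.Relation.Binary.Permutation.Setoid.Properties as ↭ₛ
open import Data.List.Relation.Binary.Pointwise using (Pointwise-≡⇒≡)
open import Data.List.Relation.Binary.Subset.Propositional using (_⊆_)
open import Data.List.Relation.Unary.All as All using (All; []; _∷_)
open import Data.List.Relation.Unary.Any using (here; there; index)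
open import Data.List.Relation.Unary.Any.Properties using (lookup-index)
open import Data.List.Relation.Unary.Linked using ([]; [-]; _∷_)
open import Data.List.Relation.Unary.Linked.Properties using (Linked⇒All)
import Data.List.Relation.Unary.Sorted.TotalOrder as Sorted
import Data.List.Relation.Unary.Sorted.TotalOrder.Properties as Sortedₚ
open import Data.List.Relation.Unary.Unique.Propositional as Unique using (Unique; []; _∷_)
import Data.List.Relation.Unary.Unique.Propositional.Properties as Uniqueₚ
import Data.List.Sort as Sort
open import Data.Maybe using (Maybe; just; nothing; fromMaybe; _>>=_)
open import Data.Nat using (ℕ; zero; suc; _+_; _*_; _∸_; _≤_; _<_; z≤n; s≤s; _≤?_; _<?_)
open import Data.Nat.Combinatorics using (_C_; nCn≡1; nCk+nC[k+1]≡[n+1]C[k+1])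
open import Data.Nat.ListAction using (sum)
open import Data.Nat.Properties
open import Data.Product using (∃; _×_; _,_; proj₁; proj₂)
open import Data.Sum using (_⊎_; inj₁; inj₂)
open import Data.Vec using (Vec; lookup; tabulate)
open import Data.Vec.Properties using (lookup∘tabulate; tabulate∘lookup; tabulate-cong)
open import Function using (_∘_; Injective)
open import Function.Bundles using (_⇔_; Equivalence)
open import Relation.Binary.Bundles using (DecTotalOrder)
open import Relation.Binary.Definitions using (tri<; tri≈; tri>)
open import Relation.Binary.PropositionalEquality
  using (_≡_; _≢_; refl; sym; trans; cong; cong₂; subst; subst₂; setoid; isEquivalence;
         module ≡-Reasoning)
open import Relation.Nullary using (¬_; Dec; yes; no; contradiction)
open import Relation.Nullary.Decidable using (decidable-stable)

private
  variable
    A B : Set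

module _ {x : A} {xs ys : List A} where

  ∈-tail : x ∉ ys → ∀ {z} → z ∈ x ∷ xs → z ∈ ys → z ∈ xs
  ∈-tail x∉ys (here refl) z∈ys = contradiction z∈ys x∉ys
  ∈-tail x∉ys (there z∈xs) _   = z∈xs

unique-⊆-⊇⇒↭ : {xs ys : List A} → Unique xs → Unique ys → xs ⊆ ys → ys ⊆ xs →
               xs ↭ ys
unique-⊆-⊇⇒↭ {xs = []} {[]} _ _ _ _ = _↭_.refl
unique-⊆-⊇⇒↭ {xs = []} {_ ∷ _} _ _ _ ys⊆[] with () ← ys⊆[] (here refl)
unique-⊆-⊇⇒↭ {A = A} {xs = x ∷ xs} x∷xs! ys! xs⊆ys ys⊆xs
  with h , t , refl ← ∈-∃++ (xs⊆ys (here refl)) =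
  ↭-trans (prep x (unique-⊆-⊇⇒↭ (Unique.tail x∷xs!) (Unique.tail x∷ht!) xs⊆ht ht⊆xs))
    (↭-sym ys↭)
  where
  ys↭ : h ++ [ x ] ++ t ↭ x ∷ h ++ t
  ys↭ = shift x h t
  x∷ht! : Unique (x ∷ h ++ t)
  x∷ht! = ↭ₛ.Unique-resp-↭ (setoid A) (↭⇒↭ₛ ys↭) ys!
  xs⊆ht : xs ⊆ h ++ t
  xs⊆ht z∈xs = ∈-tail (Uniqueₚ.Unique[x∷xs]⇒x∉xs x∷xs!)
    (∈-resp-↭ ys↭ (xs⊆ys (there z∈xs))) z∈xs
  ht⊆xs : h ++ t ⊆ xs
  ht⊆xs z∈ht = ∈-tail (Uniqueₚ.Unique[x∷xs]⇒x∉xs x∷ht!)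
    (ys⊆xs (∈-resp-↭ (↭-sym ys↭) (there z∈ht))) z∈ht

↭-allFin : ∀ {n} {xs : List (Fin n)} → Unique xs → (∀ x → x ∈ xs) → xs ↭ allFin n
↭-allFin {n} xs! ∈xs =
  unique-⊆-⊇⇒↭ xs! (Uniqueₚ.allFin⁺ n) (λ {x} _ → ∈-allFin x) (λ {x} _ → ∈xs x)

map-cong-local⁻ : {f g : A → B} (xs : List A) → map f xs ≡ map g xs →
                  All (λ x → f x ≡ g x) xs
map-cong-local⁻ []       _  = []
map-cong-local⁻ (x ∷ xs) eq = ∷-injectiveˡ eq ∷ map-cong-local⁻ xs (∷-injectiveʳ eq)

dependentProduct : List A → (A → List B) → List (A × B)
dependentProduct []       ys = []
dependentProduct (x ∷ xs) ys = map (x ,_) (ys x) ++ dependentProduct xs ys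

module _ {ys : A → List B} where

  ∈-dependentProduct⁺ : ∀ {xs x y} → x ∈ xs → y ∈ ys x → (x , y) ∈ dependentProduct xs ys
  ∈-dependentProduct⁺ {x ∷ xs} (here refl) y∈ = ∈-++⁺ˡ (∈-map⁺ (x ,_) y∈)
  ∈-dependentProduct⁺ {x ∷ xs} (there x∈) y∈ =
    ∈-++⁺ʳ (map (x ,_) (ys x)) (∈-dependentProduct⁺ x∈ y∈)

  ∈-dependentProduct⁻ : ∀ xs {x y} → (x , y) ∈ dependentProduct xs ys → x ∈ xs × y ∈ ys x
  ∈-dependentProduct⁻ (x ∷ xs) p∈ with ∈-++⁻ (map (x ,_) (ys x)) p∈
  ... | inj₁ p∈map with _ , y∈ , refl ← ∈-map⁻ (x ,_) p∈map = here refl , y∈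
  ... | inj₂ p∈rest = let x∈ , y∈ = ∈-dependentProduct⁻ xs p∈rest in there x∈ , y∈

  dependentProduct⁺ : ∀ {xs} → Unique xs → (∀ x → Unique (ys x)) →
                      Unique (dependentProduct xs ys)
  dependentProduct⁺ {[]}     _            _   = []
  dependentProduct⁺ {x ∷ xs} x∷xs!@(_ ∷ xs!) ys! =
    Uniqueₚ.++⁺ (Uniqueₚ.map⁺ (cong proj₂) (ys! x)) (dependentProduct⁺ xs! ys!) disjoint
    where
    disjoint : ∀ {p} → ¬ (p ∈ map (x ,_) (ys x) × p ∈ dependentProduct xs ys)
    disjoint (p∈map , p∈rest) with _ , _ , refl ← ∈-map⁻ (x ,_) p∈map =
      Uniqueₚ.Unique[x∷xs]⇒x∉xs x∷xs! (proj₁ (∈-dependentProduct⁻ xs p∈rest))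

  length-dependentProduct : ∀ xs → length (dependentProduct xs ys) ≡ sum (map (length ∘ ys) xs)
  length-dependentProduct []       = refl
  length-dependentProduct (x ∷ xs) = trans (length-++ (map (x ,_) (ys x)))
    (cong₂ _+_ (length-map (x ,_) (ys x)) (length-dependentProduct xs))

-- Binomial coefficients

coeffShifted-suc : ∀ m e t → coeffShifted m (suc e) (suc t) ≡ coeffShifted m e t
coeffShifted-suc m zero    t = refl
coeffShifted-suc m (suc e) t = refl

coeffShifted-> : ∀ m {e t} → t < e → coeffShifted m e t ≡ 0
coeffShifted-> m {suc e} {zero}  _         = refl
coeffShifted-> m {suc e} {suc t} (s≤s t<e) = trans (coeffShifted-suc m e t) (coeffShifted-> m t<e)

coeffShifted-∸ : ∀ m e {d t} → d ≤ t → coeffShifted m e (t ∸ d) ≡ coeffShifted m (d + e) t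
coeffShifted-∸ m e {zero}  _         = refl
coeffShifted-∸ m e {suc d} {suc t} (s≤s d≤t) =
  trans (coeffShifted-∸ m e d≤t) (sym (coeffShifted-suc m (d + e) t))

coeffShifted-zero : ∀ m e → coeffShifted (suc m) e 0 ≡ coeffShifted m e 0
coeffShifted-zero m zero    = trans (nCn≡1 (suc m)) (sym (nCn≡1 m))
coeffShifted-zero m (suc e) = refl

coeffShifted-pascal : ∀ m e t →
  coeffShifted (suc m) e (suc t) ≡ coeffShifted m e (suc t) + coeffShifted (suc m) e t
coeffShifted-pascal m zero t = begin
  suc (t + suc m) C suc m                ≡⟨ nCk+nC[k+1]≡[n+1]C[k+1] (t + suc m) m ⟨
  (t + suc m) C m + (t + suc m) C suc m  ≡⟨ cong (λ k → k C m + (t + suc m) C suc m) (+-suc t m) ⟩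
  (suc t + m) C m + (t + suc m) C suc m  ∎
  where open ≡-Reasoning
coeffShifted-pascal m (suc e) zero = begin
  coeffShifted (suc m) (suc e) 1                      ≡⟨ coeffShifted-suc (suc m) e 0 ⟩
  coeffShifted (suc m) e 0                            ≡⟨ coeffShifted-zero m e ⟩
  coeffShifted m e 0                                  ≡⟨ +-identityʳ _ ⟨
  coeffShifted m e 0 + 0                              ≡⟨ cong (_+ 0) (coeffShifted-suc m e 0) ⟨
  coeffShifted m (suc e) 1 + coeffShifted (suc m) (suc e) 0 ∎
  where open ≡-Reasoning
coeffShifted-pascal m (suc e) (suc t) = begin
  coeffShifted (suc m) (suc e) (suc (suc t))        ≡⟨ coeffShifted-suc (suc m) e (suc t) ⟩
  coeffShifted (suc m) e (suc t)                    ≡⟨ coeffShifted-pascal m e t ⟩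
  coeffShifted m e (suc t) + coeffShifted (suc m) e t
    ≡⟨ cong₂ _+_ (coeffShifted-suc m e (suc t)) (coeffShifted-suc (suc m) e t) ⟨
  coeffShifted m (suc e) (suc (suc t)) + coeffShifted (suc m) (suc e) (suc t) ∎
  where open ≡-Reasoning

-- Type B descents and compatible sequences

descent : ℤ → ℤ → ℕ
descent a b = if gtᵇ a b then 1 else 0

descentAt : ℤ → List ℤ → ℕ
descentAt a σ = descent a (fromMaybe (+ 0) (head σ))

desB-∷ : ∀ a σ → desB (a ∷ σ) ≡ descentAt a σ + desB σ
desB-∷ a []      = sym (+-identityʳ _)
desB-∷ a (b ∷ σ) = refl

descent-cases : ∀ a b → (b ℤ.< a × descent a b ≡ 1) ⊎ (a ℤ.≤ b × descent a b ≡ 0)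
descent-cases a b with b ℤ.<? a
... | yes b<a = inj₁ (b<a , refl)
... | no  b≮a = inj₂ (ℤ.≮⇒≥ b≮a , refl)

descent-< : ∀ {a b} → b ℤ.< a → descent a b ≡ 1
descent-< {a} {b} b<a with descent-cases a b
... | inj₁ (_ , d≡1)   = d≡1
... | inj₂ (a≤b , _)   = contradiction b<a (ℤ.≤⇒≯ a≤b)

descent-triangle : ∀ a b c → descent a c ≤ descent a b + descent b c
descent-triangle a b c with descent-cases a c | descent-cases a b | descent-cases b c
... | inj₂ (_ , d≡0)   | _                 | _              = ≤-trans (≤-reflexive d≡0) z≤n
... | inj₁ (_ , d≡1)   | inj₁ (_ , d₁≡1)   | _              =
  ≤-trans (≤-reflexive (trans d≡1 (sym d₁≡1))) (m≤m+n _ _)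
... | inj₁ (_ , d≡1)   | inj₂ _            | inj₁ (_ , d₂≡1) =
  ≤-trans (≤-reflexive (trans d≡1 (sym d₂≡1))) (m≤n+m _ _)
... | inj₁ (c<a , _)   | inj₂ (a≤b , _)    | inj₂ (b≤c , _) =
  contradiction c<a (ℤ.≤⇒≯ (ℤ.≤-trans a≤b b≤c))

-- Compatible t σ g: t ≥ g₁ ≥ ⋯ ≥ gₙ ≥ gₙ₊₁ = 0 with gᵢ > gᵢ₊₁ whenever i ∈ Des_B σ. Each entry
-- gᵢ bounds the remaining ones by gᵢ − [i ∈ Des_B σ]; for i = n, descentAt compares with σₙ₊₁ = 0.
data Compatible : ℕ → List ℤ → List ℕ → Set where
  []   : ∀ {t} → Compatible t [] []
  cons : ∀ {t a σ x g} → x ≤ t → descentAt a σ ≤ x →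
         Compatible (x ∸ descentAt a σ) σ g → Compatible t (a ∷ σ) (x ∷ g)

Compatible-length : ∀ {t σ g} → Compatible t σ g → length g ≡ length σ
Compatible-length []            = refl
Compatible-length (cons _ _ c)  = cong suc (Compatible-length c)

Compatible-weaken : ∀ {t t′ σ g} → t ≤ t′ → Compatible t σ g → Compatible t′ σ g
Compatible-weaken t≤t′ []               = []
Compatible-weaken t≤t′ (cons x≤t d≤x c) = cons (≤-trans x≤t t≤t′) d≤x c

compatibles : ℕ → List ℤ → List (List ℕ)
compatiblesHeadedBy : ℕ → List ℤ → List (List ℕ)

compatibles t       []          = [ [] ]
compatibles zero    σ@(_ ∷ _)   = compatiblesHeadedBy zero σ
compatibles (suc t) σ@(_ ∷ _)   = compatiblesHeadedBy (suc t) σ ++ compatibles t σ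

compatiblesHeadedBy x []      = []
compatiblesHeadedBy x (a ∷ σ) with descentAt a σ ≤? x
... | yes _ = map (x ∷_) (compatibles (x ∸ descentAt a σ) σ)
... | no  _ = []

module _ (a : ℤ) (σ : List ℤ) where

  ∈-compatiblesHeadedBy⁺ : ∀ {x g} → descentAt a σ ≤ x →
    g ∈ compatibles (x ∸ descentAt a σ) σ → x ∷ g ∈ compatiblesHeadedBy x (a ∷ σ)
  ∈-compatiblesHeadedBy⁺ {x} d≤x g∈ with descentAt a σ ≤? x
  ... | yes _   = ∈-map⁺ (x ∷_) g∈
  ... | no  d≰x = contradiction d≤x d≰x

  ∈-compatiblesHeadedBy⁻ : ∀ {x g} → g ∈ compatiblesHeadedBy x (a ∷ σ) →
    ∃ λ g′ → g ≡ x ∷ g′ × descentAt a σ ≤ x × g′ ∈ compatibles (x ∸ descentAt a σ) σ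
  ∈-compatiblesHeadedBy⁻ {x} g∈ with descentAt a σ ≤? x
  ... | yes d≤x with g′ , g′∈ , refl ← ∈-map⁻ (x ∷_) g∈ = g′ , refl , d≤x , g′∈

compatibles-sound : ∀ t σ {g} → g ∈ compatibles t σ → Compatible t σ g
compatiblesHeadedBy-sound : ∀ x a σ {g} → g ∈ compatiblesHeadedBy x (a ∷ σ) →
                            Compatible x (a ∷ σ) g

compatibles-sound t       []      (here refl) = []
compatibles-sound zero    (a ∷ σ) g∈ = compatiblesHeadedBy-sound zero a σ g∈
compatibles-sound (suc t) (a ∷ σ) g∈ with ∈-++⁻ (compatiblesHeadedBy (suc t) (a ∷ σ)) g∈
... | inj₁ g∈h = compatiblesHeadedBy-sound (suc t) a σ g∈h
... | inj₂ g∈c = Compatible-weaken (n≤1+n t) (compatibles-sound t (a ∷ σ) g∈c)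

compatiblesHeadedBy-sound x a σ g∈
  with g′ , refl , d≤x , g′∈ ← ∈-compatiblesHeadedBy⁻ a σ g∈ =
  cons ≤-refl d≤x (compatibles-sound _ σ g′∈)

compatiblesHeadedBy-⊆ : ∀ {x t a σ} → x ≤ t →
                        compatiblesHeadedBy x (a ∷ σ) ⊆ compatibles t (a ∷ σ)
compatiblesHeadedBy-⊆ {t = zero}  z≤n   g∈ = g∈
compatiblesHeadedBy-⊆ {t = suc t} x≤1+t g∈ with m≤n⇒m<n∨m≡n x≤1+t
... | inj₂ refl      = ∈-++⁺ˡ g∈
... | inj₁ (s≤s x≤t) = ∈-++⁺ʳ _ (compatiblesHeadedBy-⊆ x≤t g∈)

compatibles-complete : ∀ {t σ g} → Compatible t σ g → g ∈ compatibles t σ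
compatibles-complete                []               = here refl
compatibles-complete {σ = a ∷ σ} (cons x≤t d≤x c) =
  compatiblesHeadedBy-⊆ x≤t (∈-compatiblesHeadedBy⁺ a σ d≤x (compatibles-complete c))

compatibles-unique : ∀ t σ → Unique (compatibles t σ)
compatiblesHeadedBy-unique : ∀ x σ → Unique (compatiblesHeadedBy x σ)

compatibles-unique t       []      = [] ∷ []
compatibles-unique zero    (a ∷ σ) = compatiblesHeadedBy-unique zero (a ∷ σ)
compatibles-unique (suc t) (a ∷ σ) =
  Uniqueₚ.++⁺ (compatiblesHeadedBy-unique (suc t) (a ∷ σ)) (compatibles-unique t (a ∷ σ))
              disjoint
  where
  disjoint : ∀ {g} →
    ¬ (g ∈ compatiblesHeadedBy (suc t) (a ∷ σ) × g ∈ compatibles t (a ∷ σ))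
  disjoint (g∈h , g∈c) with _ , refl , _ ← ∈-compatiblesHeadedBy⁻ a σ g∈h
    with cons 1+t≤t _ _ ← compatibles-sound t (a ∷ σ) g∈c = 1+n≰n 1+t≤t

compatiblesHeadedBy-unique x []      = []
compatiblesHeadedBy-unique x (a ∷ σ) with descentAt a σ ≤? x
... | yes _ = Uniqueₚ.map⁺ ∷-injectiveʳ (compatibles-unique (x ∸ descentAt a σ) σ)
... | no  _ = []

length-compatibles : ∀ t σ → length (compatibles t σ) ≡ coeffShifted (length σ) (desB σ) t
length-compatiblesHeadedBy : ∀ x a σ →
  length (compatiblesHeadedBy x (a ∷ σ)) ≡ coeffShifted (length σ) (desB (a ∷ σ)) x

length-compatibles t       []      = refl
length-compatibles zero    (a ∷ σ) = trans (length-compatiblesHeadedBy zero a σ)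
  (sym (coeffShifted-zero (length σ) (desB (a ∷ σ))))
length-compatibles (suc t) (a ∷ σ) = begin
  length (compatiblesHeadedBy (suc t) (a ∷ σ) ++ compatibles t (a ∷ σ))
    ≡⟨ length-++ (compatiblesHeadedBy (suc t) (a ∷ σ)) ⟩
  length (compatiblesHeadedBy (suc t) (a ∷ σ)) + length (compatibles t (a ∷ σ))
    ≡⟨ cong₂ _+_ (length-compatiblesHeadedBy (suc t) a σ) (length-compatibles t (a ∷ σ)) ⟩
  coeffShifted m e (suc t) + coeffShifted (suc m) e t
    ≡⟨ coeffShifted-pascal m e t ⟨
  coeffShifted (suc m) e (suc t) ∎
  where
  open ≡-Reasoning
  m = length σ
  e = desB (a ∷ σ)

length-compatiblesHeadedBy x a σ rewrite desB-∷ a σ with descentAt a σ ≤? x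
... | yes d≤x = begin
  length (map (x ∷_) (compatibles (x ∸ d) σ))  ≡⟨ length-map (x ∷_) (compatibles (x ∸ d) σ) ⟩
  length (compatibles (x ∸ d) σ)               ≡⟨ length-compatibles (x ∸ d) σ ⟩
  coeffShifted (length σ) (desB σ) (x ∸ d)     ≡⟨ coeffShifted-∸ (length σ) (desB σ) d≤x ⟩
  coeffShifted (length σ) (d + desB σ) x       ∎
  where
  open ≡-Reasoning
  d = descentAt a σ
... | no  d≰x = sym (coeffShifted-> (length σ) (<-≤-trans (≰⇒> d≰x) (m≤m+n _ _)))

-- Forests

module _ {n : ℕ} (p : Fin n → Maybe (Fin n)) where

  iterParent-+ : ∀ j i x → iterParent p (j + i) x ≡ (iterParent p i x >>= iterParent p j)
  iterParent-+ zero    i x with iterParent p i x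
  ... | nothing = refl
  ... | just _  = refl
  iterParent-+ (suc j) i x rewrite iterParent-+ j i x with iterParent p i x
  ... | nothing = refl
  ... | just _  = refl

  iterParent-cycle : ∀ {k x} → iterParent p (suc k) x ≡ just x →
                     ∀ m → iterParent p (m * suc k) x ≡ just x
  iterParent-cycle         cycle zero    = refl
  iterParent-cycle {k} {x} cycle (suc m) = begin
    iterParent p (suc k + m * suc k) x
                                               ≡⟨ cong (λ i → iterParent p i x) (+-comm (suc k) (m * suc k)) ⟩
    iterParent p (m * suc k + suc k) x         ≡⟨ iterParent-+ (m * suc k) (suc k) x ⟩
    (iterParent p (suc k) x >>= iterParent p (m * suc k))
                                               ≡⟨ cong (_>>= iterParent p (m * suc k)) cycle ⟩
    iterParent p (m * suc k) x                 ≡⟨ iterParent-cycle cycle m ⟩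
    just x                                     ∎
    where open ≡-Reasoning

<F-irrefl : ∀ {n} (F : Forest n) {x} → ¬ (x <[ F ] x)
<F-irrefl {n} F {x} (k , cycle) = contradiction nothing≡just λ ()
  where
  p : Fin n → Maybe (Fin n)
  p = parent F
  open ≡-Reasoning
  nothing≡just : nothing ≡ just x
  nothing≡just = begin
    nothing                                      ≡⟨ cong (_>>= iterParent p (n * k)) (acyclic F x) ⟨
    (iterParent p n x >>= iterParent p (n * k))  ≡⟨ iterParent-+ p (n * k) n x ⟨
    iterParent p (n * k + n) x                   ≡⟨ cong (λ i → iterParent p i x) (+-comm (n * k) n) ⟩
    iterParent p (n + n * k) x                   ≡⟨ cong (λ i → iterParent p i x) (*-suc n k) ⟨
    iterParent p (n * suc k) x                   ≡⟨ iterParent-cycle p cycle n ⟩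
    just x                                       ∎

-- The reading order of a labelled map

module ReadingOrder {n : ℕ} (w : Fin n → ℤ) (w-injective : Injective _≡_ _≡_ w)
                    (f : Fin n → ℕ) where

  infix 4 _⊑_ _⊑?_

  -- x ⊑ y: x is read no later than y when reading by decreasing f, ties by increasing label.
  _⊑_ : Fin n → Fin n → Set
  x ⊑ y = f y + descent (w x) (w y) ≤ f x

  -- x ⊑ ⋆ for a virtual last vertex ⋆ of label 0 and value 0, the σₙ₊₁ = 0 of Des_B.
  Final : Fin n → Set
  Final x = descent (w x) (+ 0) ≤ f x

  ⊑-intro : ∀ {x y} → f y ≤ f x → (w y ℤ.< w x → f y < f x) → x ⊑ y
  ⊑-intro {x} {y} fy≤fx strict with descent-cases (w x) (w y)
  ... | inj₁ (wy<wx , d≡1) rewrite d≡1 =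
    ≤-trans (≤-reflexive (+-comm (f y) 1)) (strict wy<wx)
  ... | inj₂ (_ , d≡0)     rewrite d≡0 =
    ≤-trans (≤-reflexive (+-identityʳ (f y))) fy≤fx

  ⊑⇒≥ : ∀ {x y} → x ⊑ y → f y ≤ f x
  ⊑⇒≥ = m+n≤o⇒m≤o _

  ⊑⇒> : ∀ {x y} → x ⊑ y → w y ℤ.< w x → f y < f x
  ⊑⇒> {x} {y} x⊑y wy<wx =
    ≤-trans (≤-reflexive (+-comm 1 (f y))) (subst (λ d → f y + d ≤ f x) (descent-< wy<wx) x⊑y)

  Final-intro : ∀ {x} → (+ 0 ℤ.< w x → 1 ≤ f x) → Final x
  Final-intro {x} positive with descent-cases (w x) (+ 0)
  ... | inj₁ (0<wx , d≡1) = ≤-trans (≤-reflexive d≡1) (positive 0<wx)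
  ... | inj₂ (_ , d≡0)    = ≤-trans (≤-reflexive d≡0) z≤n

  Final⇒ : ∀ {x} → Final x → + 0 ℤ.< w x → 1 ≤ f x
  Final⇒ final 0<wx = ≤-trans (≤-reflexive (sym (descent-< 0<wx))) final

  ⊑-refl : ∀ {x} → x ⊑ x
  ⊑-refl = ⊑-intro ≤-refl (λ wx<wx → contradiction wx<wx (ℤ.<-irrefl refl))

  ⊑-trans : ∀ {x y z} → x ⊑ y → y ⊑ z → x ⊑ z
  ⊑-trans {x} {y} {z} x⊑y y⊑z = begin
    f z + dxz          ≤⟨ +-monoʳ-≤ (f z) (descent-triangle (w x) (w y) (w z)) ⟩
    f z + (dxy + dyz)  ≡⟨ cong (λ d → f z + d) (+-comm dxy dyz) ⟩
    f z + (dyz + dxy)  ≡⟨ +-assoc (f z) dyz dxy ⟨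
    f z + dyz + dxy    ≤⟨ +-monoˡ-≤ dxy y⊑z ⟩
    f y + dxy          ≤⟨ x⊑y ⟩
    f x                ∎
    where
    open ≤-Reasoning
    dxy = descent (w x) (w y)
    dyz = descent (w y) (w z)
    dxz = descent (w x) (w z)

  ⊑-antisym : ∀ {x y} → x ⊑ y → y ⊑ x → x ≡ y
  ⊑-antisym {x} {y} x⊑y y⊑x with ℤ.<-cmp (w x) (w y)
  ... | tri< wx<wy _ _ = contradiction (⊑⇒> y⊑x wx<wy) (≤⇒≯ (⊑⇒≥ x⊑y))
  ... | tri≈ _ wx≡wy _ = w-injective wx≡wy
  ... | tri> _ _ wy<wx = contradiction (⊑⇒> x⊑y wy<wx) (≤⇒≯ (⊑⇒≥ y⊑x))

  ⊑-total : ∀ x y → x ⊑ y ⊎ y ⊑ x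
  ⊑-total x y with <-cmp (f x) (f y) | ℤ.≤-total (w x) (w y)
  ... | tri< fx<fy _ _ | _         = inj₂ (⊑-intro (<⇒≤ fx<fy) (λ _ → fx<fy))
  ... | tri> _ _ fy<fx | _         = inj₁ (⊑-intro (<⇒≤ fy<fx) (λ _ → fy<fx))
  ... | tri≈ _ fx≡fy _ | inj₁ wx≤wy =
    inj₁ (⊑-intro (≤-reflexive (sym fx≡fy)) (λ wy<wx → contradiction wy<wx (ℤ.≤⇒≯ wx≤wy)))
  ... | tri≈ _ fx≡fy _ | inj₂ wy≤wx =
    inj₂ (⊑-intro (≤-reflexive fx≡fy) (λ wx<wy → contradiction wx<wy (ℤ.≤⇒≯ wy≤wx)))

  _⊑?_ : ∀ x y → Dec (x ⊑ y)
  x ⊑? y = f y + descent (w x) (w y) ≤? f x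

  ⊑-decTotalOrder : DecTotalOrder _ _ _
  ⊑-decTotalOrder = record
    { isDecTotalOrder = record
      { isTotalOrder = record
        { isPartialOrder = record
          { isPreorder = record
            { isEquivalence = isEquivalence
            ; reflexive     = λ { refl → ⊑-refl }
            ; trans         = ⊑-trans
            }
          ; antisym = ⊑-antisym
          }
        ; total = ⊑-total
        }
      ; _≟_  = Fin._≟_
      ; _≤?_ = _⊑?_
      }
    }

  open DecTotalOrder ⊑-decTotalOrder using (totalOrder)
  open Sorted totalOrder using (Sorted)
  open Sort ⊑-decTotalOrder using (sort; sort-↭; sort-↗)

  readingWord : List (Fin n)
  readingWord = sort (allFin n)

  ⊑-Final : ∀ {x y} → x ⊑ y → Final y → Final x
  ⊑-Final {x} {y} x⊑y final = begin
    descent (w x) (+ 0)                        ≤⟨ descent-triangle (w x) (w y) (+ 0) ⟩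
    descent (w x) (w y) + descent (w y) (+ 0)  ≤⟨ +-monoʳ-≤ (descent (w x) (w y)) final ⟩
    descent (w x) (w y) + f y                  ≡⟨ +-comm (descent (w x) (w y)) (f y) ⟩
    f y + descent (w x) (w y)                  ≤⟨ x⊑y ⟩
    f x                                        ∎
    where open ≤-Reasoning

  sorted⇒compatible : ∀ {t xs} → All (λ x → f x ≤ t) xs → Sorted xs → All Final xs →
                      Compatible t (map w xs) (map f xs)
  sorted⇒compatible []          []        []          = []
  sorted⇒compatible (fx≤t ∷ []) [-]       (final ∷ []) = cons fx≤t final []
  sorted⇒compatible {xs = x ∷ y ∷ _} (fx≤t ∷ _) (x⊑y ∷ sorted) (_ ∷ finals) =
    cons fx≤t (m+n≤o⇒n≤o (f y) x⊑y) (sorted⇒compatible tail≤ sorted finals)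
    where
    tail≤ : All (λ z → f z ≤ f x ∸ descent (w x) (w y)) (y ∷ _)
    tail≤ = All.map (λ y⊑z → m+n≤o⇒m≤o∸n _ (≤-trans (+-monoˡ-≤ _ (⊑⇒≥ y⊑z)) x⊑y))
                    (Linked⇒All ⊑-trans ⊑-refl sorted)

  compatible⇒sorted : ∀ {t} xs → Compatible t (map w xs) (map f xs) →
                      All (λ x → f x ≤ t) xs × Sorted xs × All Final xs
  compatible⇒sorted []          []                   = [] , [] , []
  compatible⇒sorted (x ∷ [])    (cons fx≤t final []) = (fx≤t ∷ []) , [-] , (final ∷ [])
  compatible⇒sorted (x ∷ y ∷ l) (cons fx≤t d≤fx c)
    with bounds@(fy≤ ∷ _) , sorted , finals@(final ∷ _) ← compatible⇒sorted (y ∷ l) c =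
    (fx≤t ∷ All.map (λ fz≤ → ≤-trans fz≤ (≤-trans (m∸n≤m (f x) (descent (w x) (w y))) fx≤t))
                    bounds) ,
    (x⊑y ∷ sorted) , (⊑-Final x⊑y final ∷ finals)
    where
    x⊑y : x ⊑ y
    x⊑y = m≤o∸n⇒m+n≤o (f y) d≤fx fy≤

  sorted-Final : ∀ {xs} → Sorted xs → (∀ {z} → z ∈ xs → All (_⊑ z) xs → Final z) →
                 All Final xs
  sorted-Final []  _        = []
  sorted-Final [-] greatest = greatest (here refl) (⊑-refl ∷ []) ∷ []
  sorted-Final (x⊑y ∷ sorted) greatest = ⊑-Final x⊑y (All.head finals) ∷ finals
    where
    finals = sorted-Final sorted λ z∈ ⊑z →
      greatest (there z∈) (⊑-trans x⊑y (All.head ⊑z) ∷ ⊑z)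

  readingWord-↗ : Sorted readingWord
  readingWord-↗ = sort-↗ (allFin n)

  ∈-readingWord : ∀ x → x ∈ readingWord
  ∈-readingWord x = ∈-resp-↭ (↭-sym (sort-↭ (allFin n))) (∈-allFin x)

  readingWord-unique : Unique readingWord
  readingWord-unique =
    ↭ₛ.Unique-resp-↭ (setoid (Fin n)) (↭⇒↭ₛ (↭-sym (sort-↭ (allFin n)))) (Uniqueₚ.allFin⁺ n)

  sorted⇒readingWord : ∀ {xs} → Sorted xs → xs ↭ allFin n → readingWord ≡ xs
  sorted⇒readingWord xs↗ xs↭ = Pointwise-≡⇒≡ (Sortedₚ.↗↭↗⇒≋ totalOrder readingWord-↗ xs↗
    (↭⇒↭ₛ (↭-trans (sort-↭ (allFin n)) (↭-sym xs↭))))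

  module _ (F : Forest n) where

    partition⇒⊑ : IsTypeBPartition F w f → ∀ {x y} → y <[ F ] x → y ⊑ x
    partition⇒⊑ (monotone , strict , _) {x} {y} y<x =
      ⊑-intro (monotone x y (inj₂ y<x)) (strict x y y<x)

    greatest⇒Final : IsTypeBPartition F w f → ∀ {z} → (∀ y → y ⊑ z) → Final z
    greatest⇒Final P@(_ , _ , positiveRoot) {z} greatest with parent F z in eq
    ... | nothing = Final-intro (positiveRoot z eq)
    ... | just p  = contradiction (subst (z <[ F ]_) (sym z≡p) z<p) (<F-irrefl F)
      where
      z<p : z <[ F ] p
      z<p = zero , eq
      z≡p : z ≡ p
      z≡p = ⊑-antisym (partition⇒⊑ P z<p) (greatest p)

    readingWord-Final : IsTypeBPartition F w f → All Final readingWord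
    readingWord-Final P = sorted-Final readingWord-↗
      λ _ ⊑z → greatest⇒Final P (λ y → All.lookup ⊑z (∈-readingWord y))

    sorted-respects-<F : IsTypeBPartition F w f → ∀ {xs} → Sorted xs →
      ∀ j k → List.lookup xs j <[ F ] List.lookup xs k → toℕ j < toℕ k
    sorted-respects-<F P {xs} sorted j k xⱼ<xₖ = decidable-stable (toℕ j <? toℕ k) λ j≮k →
      <F-irrefl F (subst (_<[ F ] List.lookup xs k) (xⱼ≡xₖ j≮k) xⱼ<xₖ)
      where
      xⱼ≡xₖ : ¬ toℕ j < toℕ k → List.lookup xs j ≡ List.lookup xs k
      xⱼ≡xₖ j≮k = ⊑-antisym (partition⇒⊑ P xⱼ<xₖ)
                            (Sortedₚ.lookup-mono-≤ totalOrder sorted (≮⇒≥ j≮k))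

    readingWord-linearExtension : IsTypeBPartition F w f → IsLinearExtension F readingWord
    readingWord-linearExtension P =
      readingWord-unique , ∈-readingWord , sorted-respects-<F P readingWord-↗

    linearExtension⇒⊑ : ∀ {xs} → IsLinearExtension F xs → Sorted xs →
                        ∀ {x y} → y <[ F ] x → y ⊑ x
    linearExtension⇒⊑ {xs} (_ , ∈xs , respects) sorted {x} {y} y<x =
      subst₂ _⊑_ (sym (lookup-index (∈xs y))) (sym (lookup-index (∈xs x)))
        (Sortedₚ.lookup-mono-≤ totalOrder sorted (<⇒≤ (respects (index (∈xs y)) (index (∈xs x))
          (subst₂ _<[ F ]_ (lookup-index (∈xs y)) (lookup-index (∈xs x)) y<x))))

    sorted⇒partition : ∀ {xs} → IsLinearExtension F xs → Sorted xs → All Final xs →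
                       IsTypeBPartition F w f
    sorted⇒partition ext@(_ , ∈xs , _) sorted finals = monotone , strict , positiveRoot
      where
      monotone : ∀ x y → x ≥[ F ] y → f x ≤ f y
      monotone x .x (inj₁ refl) = ≤-refl
      monotone x y  (inj₂ y<x)  = ⊑⇒≥ (linearExtension⇒⊑ ext sorted y<x)
      strict : ∀ x y → y <[ F ] x → w x ℤ.< w y → f x < f y
      strict x y y<x = ⊑⇒> (linearExtension⇒⊑ ext sorted y<x)
      positiveRoot : ∀ x → IsRoot F x → + 0 ℤ.< w x → 1 ≤ f x
      positiveRoot x _ = Final⇒ (All.lookup finals (∈xs x))

-- Encoding partitions

assign : ∀ {n} → List (Fin n) → List ℕ → Fin n → ℕ
assign (y ∷ ys) (v ∷ vs) x with x Fin.≟ y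
... | yes _ = v
... | no  _ = assign ys vs x
assign _        _        _ = 0

map-assign : ∀ {n} {xs : List (Fin n)} {vs} → Unique xs → length vs ≡ length xs →
             map (assign xs vs) xs ≡ vs
map-assign {xs = []}     {[]}     _ _ = refl
map-assign {xs = y ∷ ys} {v ∷ vs} (y∉ys ∷ ys!) len = cong₂ _∷_ assign-head
  (trans (map-cong-local (All.map assign-tail y∉ys)) (map-assign ys! (suc-injective len)))
  where
  assign-head : assign (y ∷ ys) (v ∷ vs) y ≡ v
  assign-head with y Fin.≟ y
  ... | yes _   = refl
  ... | no  y≢y = contradiction refl y≢y
  assign-tail : ∀ {z} → y ≢ z → assign (y ∷ ys) (v ∷ vs) z ≡ assign ys vs z
  assign-tail {z} y≢z with z Fin.≟ y
  ... | yes z≡y = contradiction (sym z≡y) y≢z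
  ... | no  _   = refl

module Encoding {n : ℕ} (F : Forest n) (w : Fin n → ℤ) (w-injective : Injective _≡_ _≡_ w)
  where

  open ReadingOrder w w-injective

  IsBoundedPartition : ℕ → Vec ℕ n → Set
  IsBoundedPartition t v = IsTypeBPartition F w (lookup v) × (∀ x → lookup v x ≤ t)

  encode : Vec ℕ n → List ℤ × List ℕ
  encode v = map w (readingWord (lookup v)) , map (lookup v) (readingWord (lookup v))

  encode-injective : Injective _≡_ _≡_ encode
  encode-injective {v} {v′} encode≡ = begin
    v                    ≡⟨ tabulate∘lookup v ⟨
    tabulate (lookup v)  ≡⟨ tabulate-cong lookup≗ ⟩
    tabulate (lookup v′) ≡⟨ tabulate∘lookup v′ ⟩
    v′                   ∎
    where
    open ≡-Reasoning
    word≡ : readingWord (lookup v) ≡ readingWord (lookup v′)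
    word≡ = map-injective w-injective (cong proj₁ encode≡)
    values≡ : map (lookup v) (readingWord (lookup v))
            ≡ map (lookup v′) (readingWord (lookup v))
    values≡ = trans (cong proj₂ encode≡) (cong (map (lookup v′)) (sym word≡))
    lookup≗ : ∀ x → lookup v x ≡ lookup v′ x
    lookup≗ x = All.lookup (map-cong-local⁻ _ values≡) (∈-readingWord (lookup v) x)

  encode-bounded : ∀ {t v} → IsBoundedPartition t v →
    InL F w (proj₁ (encode v)) × Compatible t (proj₁ (encode v)) (proj₂ (encode v))
  encode-bounded {v = v} (P , bounded) =
    (readingWord f , readingWord-linearExtension f F P , refl) ,
    sorted⇒compatible f (All.tabulate λ {x} _ → bounded x) (readingWord-↗ f)
                        (readingWord-Final f F P)
    where
    f = lookup v

  decode : ∀ {t σ g} → InL F w σ → Compatible t σ g →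
           ∃ λ v → IsBoundedPartition t v × encode v ≡ (σ , g)
  decode {t} {g = g} (xs , ext@(xs! , ∈xs , _) , refl) compatible =
    v , (sorted⇒partition f F ext sorted finals , λ x → All.lookup bounds (∈xs x)) ,
    cong₂ _,_ (cong (map w) word≡) (trans (cong (map f) word≡) f∘xs)
    where
    v = tabulate (assign xs g)
    f = lookup v
    f∘xs : map f xs ≡ g
    f∘xs = trans (map-cong (lookup∘tabulate (assign xs g)) xs)
                 (map-assign xs! (trans (Compatible-length compatible) (length-map w xs)))
    sortedness = compatible⇒sorted f xs (subst (Compatible t (map w xs)) (sym f∘xs) compatible)
    bounds = proj₁ sortedness
    sorted = proj₁ (proj₂ sortedness)
    finals = proj₂ (proj₂ sortedness)
    word≡ : readingWord f ≡ xs
    word≡ = sorted⇒readingWord f sorted (↭-allFin xs! ∈xs)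

  length-compatibles-InL : ∀ t {σ} → InL F w σ →
                           length (compatibles t σ) ≡ coeffShifted n (desB σ) t
  length-compatibles-InL t {σ} (xs , (xs! , ∈xs , _) , refl) =
    trans (length-compatibles t σ) (cong (λ m → coeffShifted m (desB σ) t) length≡n)
    where
    length≡n : length (map w xs) ≡ n
    length≡n = trans (length-map w xs)
      (trans (↭-length (↭-allFin xs! ∈xs)) (length-tabulate {n = n} (λ x → x)))

theorem2p4 : (n : ℕ) (F : Forest n) (w : Fin n → ℤ) → IsSignedLabeling n w →
  (Ls : List (List ℤ)) → Unique Ls → (∀ σ → (σ ∈ Ls) ⇔ InL F w σ) →
  (t : ℕ) →
  (Ps : List (Vec ℕ n)) → Unique Ps →
  (∀ f → (f ∈ Ps) ⇔ (IsTypeBPartition F w (lookup f) × (∀ x → lookup f x ≤ t))) →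
  length Ps ≡ sum (map (λ σ → coeffShifted n (desB σ) t) Ls)
theorem2p4 n F w (_ , ∣w∣-injective , _) Ls Ls! Ls⇔ t Ps Ps! Ps⇔ = begin
  length Ps                                       ≡⟨ length-map encode Ps ⟨
  length (map encode Ps)                          ≡⟨ ↭-length encode-↭ ⟩
  length (dependentProduct Ls (compatibles t))    ≡⟨ length-dependentProduct Ls ⟩
  sum (map (length ∘ compatibles t) Ls)           ≡⟨ cong sum (map-cong-local (All.tabulate count)) ⟩
  sum (map (λ σ → coeffShifted n (desB σ) t) Ls)  ∎
  where
  open ≡-Reasoning
  open Equivalence
  open Encoding F w (λ wx≡wy → ∣w∣-injective _ _ (cong ℤ.∣_∣ wx≡wy))
  count : ∀ {σ} → σ ∈ Ls → length (compatibles t σ) ≡ coeffShifted n (desB σ) t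
  count {σ} σ∈Ls = length-compatibles-InL t (to (Ls⇔ σ) σ∈Ls)
  encoded⊆ : map encode Ps ⊆ dependentProduct Ls (compatibles t)
  encoded⊆ p∈ with v , v∈Ps , refl ← ∈-map⁻ encode p∈ =
    let inL , compatible = encode-bounded {v = v} (to (Ps⇔ v) v∈Ps)
    in ∈-dependentProduct⁺ (from (Ls⇔ _) inL) (compatibles-complete compatible)
  ⊆encoded : dependentProduct Ls (compatibles t) ⊆ map encode Ps
  ⊆encoded {σ , g} p∈ with σ∈Ls , g∈ ← ∈-dependentProduct⁻ Ls p∈
    with v , bounded , encode≡ ← decode (to (Ls⇔ σ) σ∈Ls) (compatibles-sound t σ g∈) =
    subst (_∈ map encode Ps) encode≡ (∈-map⁺ encode (from (Ps⇔ v) bounded))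
  encode-↭ : map encode Ps ↭ dependentProduct Ls (compatibles t)
  encode-↭ = unique-⊆-⊇⇒↭ (Uniqueₚ.map⁺ encode-injective Ps!)
    (dependentProduct⁺ Ls! (λ σ → compatibles-unique t σ)) encoded⊆ ⊆encoded
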